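{- Let $G=(V,E)$ be a connected graph with at least two vertices, $\mu$ a nice $k$-expression of $G$ and $\hat T_\mu$ its augmented syntax tree. For every node $t\in V(\hat T_\mu)$ and $\ell\in L_t$, $V_t^\ell\cap D_t=\emptyset$ implies $\ell\in L^{\mathrm{live}}_t$. If moreover $t$ is not the child of a dead node, then for every $\ell\in L_t$ we have $V_t^\ell\cap D_t=\emptyset$ if and only if $\ell\in L^{\mathrm{live}}_t$.
   Context: Clique-expressions use operations introduce $\ell(v)$, disjoint union $\oplus$, relabel $\rho_{i\to j}$, join $\eta_{i,j}$ ($i\ne j$, adds all edges between label-$i$ and label-$j$ vertices); a $k$-expression uses labels $1,\dots,k$ only. For a node $t$, $G_t=(V_t,E_t)$ is the graph built at $t$, $V_t^\ell$ its vertices with label $\ell$, $L_t=\{\ell:V_t^\ell\neq\emptyset\}$, and $D_t=\{v\in V_t:\text{all edges of }G\text{ incident to }v\text{ lie in }E_t\}$. Irredundant: at each join node $\eta_{i,j}(G_{t'})$ there is no edge of $G_{t'}$ between $V_{t'}^i$ and $V_{t'}^j$. Nice: irredundant, every join node $\eta_{i,j}(G_{t'})$ adds at least one edge and has $V_{t'}^i,V_{t'}^j\ne\emptyset$, and every relabel node $\rho_{i\to j}(G_{t'})$ has $V_{t'}^i,V_{t'}^j\neq\emptyset$. The augmented syntax tree $\hat T_\mu$ is obtained from the syntax tree by inserting, directly above each join node $t=\eta_{i,j}(G_{t'})$, a dead node $\mathrm{dead}_i$ if $V_t^i\subseteq D_t\setminus D_{t'}$ and a dead node $\mathrm{dead}_j$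 if $V_t^j\subseteq D_t\setminus D_{t'}$ (in any order if both); dead nodes inherit $G_t,V_t,D_t,V_t^\ell$ from their child. Live labels are defined inductively: $L^{\mathrm{live}}_t=\{\ell\}$ for $t=\ell(v)$; $L^{\mathrm{live}}_{t'}\setminus\{i\}$ for $t=\rho_{i\to j}(G_{t'})$; $L^{\mathrm{live}}_{t'}$ for $t=\eta_{i,j}(G_{t'})$; $L^{\mathrm{live}}_{t'}\setminus\{\ell\}$ for $t=\mathrm{dead}_\ell(G_{t'})$; $L^{\mathrm{live}}_{t_1}\cup L^{\mathrm{live}}_{t_2}$ for $t=G_{t_1}\oplus G_{t_2}$. -}

module Defs where

open import Data.Nat using (ℕ)
open import Data.Fin using (Fin)
open import Data.Empty using (⊥)
open import Data.Unit using (⊤)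
open import Data.Product using (Σ; ∃; _×_; _,_)
open import Data.Sum using (_⊎_)
open import Relation.Nullary using (¬_)
open import Relation.Binary.PropositionalEquality using (_≡_; _≢_)
open import Relation.Binary.Construct.Closure.ReflexiveTransitive using (Star)

record Graph (n : ℕ) : Set₁ where
  field
    E     : Fin n → Fin n → Set
    sym   : ∀ {u v} → E u v → E v u
    irrefl : ∀ {u} → ¬ E u u
open Graph public

Connected : ∀ {n} → Graph n → Set
Connected G = ∀ u v → Star (E G) u v

data Expr (n k : ℕ) : Set where
  intro : Fin k → Fin n → Expr n k
  _⊕_   : Expr n k → Expr n k → Expr n k
  ρ     : (i j : Fin k) → i ≢ j → Expr n k → Expr n k
  η     : (i j : Fin k) → i ≢ j → Expr n k → Expr n k

module _ {n k : ℕ} where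

  -- Lab e v ℓ : v ∈ V_t^ℓ (vertex v is in the graph built by e and has label ℓ)
  Lab : Expr n k → Fin n → Fin k → Set
  Lab (intro ℓ v) a m = (a ≡ v) × (m ≡ ℓ)
  Lab (e₁ ⊕ e₂) a m = Lab e₁ a m ⊎ Lab e₂ a m
  Lab (ρ i j _ e) a m = (Lab e a m × m ≢ i) ⊎ (Lab e a i × m ≡ j)
  Lab (η i j _ e) a m = Lab e a m

  InV : Expr n k → Fin n → Set
  InV e v = ∃ λ ℓ → Lab e v ℓ

  Edge : Expr n k → Fin n → Fin n → Set
  Edge (intro ℓ v) a b = ⊥
  Edge (e₁ ⊕ e₂) a b = Edge e₁ a b ⊎ Edge e₂ a b
  Edge (ρ i j _ e) a b = Edge e a b
  Edge (η i j _ e) a b = Edge e a b ⊎ ((Lab e a i × Lab e b j) ⊎ (Lab e a j × Lab e b i))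

  DisjointUnions : Expr n k → Set
  DisjointUnions (intro ℓ v) = ⊤
  DisjointUnions (e₁ ⊕ e₂) =
    DisjointUnions e₁ × DisjointUnions e₂ × (∀ v → InV e₁ v → InV e₂ v → ⊥)
  DisjointUnions (ρ i j _ e) = DisjointUnions e
  DisjointUnions (η i j _ e) = DisjointUnions e

  IsExprOf : Graph n → Expr n k → Set
  IsExprOf G μ =
    DisjointUnions μ × (∀ v → InV μ v) × (∀ u v → (Edge μ u v → E G u v) × (E G u v → Edge μ u v))

  NonEmptyLabel : Expr n k → Fin k → Set
  NonEmptyLabel e ℓ = ∃ λ v → Lab e v ℓ

  Nice : Expr n k → Set
  Nice (intro ℓ v) = ⊤
  Nice (e₁ ⊕ e₂) = Nice e₁ × Nice e₂
  Nice (ρ i j _ e) = Nice e × NonEmptyLabel e i × NonEmptyLabel e j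
  Nice (η i j q e) =
    Nice e
    × (∀ u v → Lab e u i → Lab e v j → ¬ Edge e u v)
    × (∃ λ u → ∃ λ v → Edge (η i j q e) u v × ¬ Edge e u v)
    × NonEmptyLabel e i × NonEmptyLabel e j

  -- D_t : vertices of G_t all of whose G-edges already lie in E_t
  Dead : Graph n → Expr n k → Fin n → Set
  Dead G e v = InV e v × (∀ w → E G v w → Edge e v w)

data ATree (n k : ℕ) : Set where
  aintro : Fin k → Fin n → ATree n k
  aunion : ATree n k → ATree n k → ATree n k
  arel   : (i j : Fin k) → i ≢ j → ATree n k → ATree n k
  ajoin  : (i j : Fin k) → i ≢ j → ATree n k → ATree n k
  adead  : Fin k → ATree n k → ATree n k

module _ {n k : ℕ} where

  -- the expression whose graph G_t is attached to a node (dead nodes inherit from child)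
  erase : ATree n k → Expr n k
  erase (aintro ℓ v) = intro ℓ v
  erase (aunion a b) = erase a ⊕ erase b
  erase (arel i j q a) = ρ i j q (erase a)
  erase (ajoin i j q a) = η i j q (erase a)
  erase (adead ℓ a) = erase a

  -- condition for inserting dead_ℓ above the join node t = η i j q e :
  -- V_t^ℓ ⊆ D_t ∖ D_{t'}
  DeadCond : Graph n → (i j : Fin k) → i ≢ j → Expr n k → Fin k → Set
  DeadCond G i j q e ℓ = ∀ v → Lab (η i j q e) v ℓ → Dead G (η i j q e) v × ¬ Dead G e v

  -- Aug G μ τ : τ is an augmented syntax tree of μ (any order of two dead nodes)
  data Aug (G : Graph n) : Expr n k → ATree n k → Set where
    aug-intro : ∀ {ℓ v} → Aug G (intro ℓ v) (aintro ℓ v)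
    aug-union : ∀ {e₁ e₂ τ₁ τ₂} → Aug G e₁ τ₁ → Aug G e₂ τ₂ → Aug G (e₁ ⊕ e₂) (aunion τ₁ τ₂)
    aug-rel   : ∀ {i j q e τ} → Aug G e τ → Aug G (ρ i j q e) (arel i j q τ)
    aug-join0 : ∀ {i j q e τ} → Aug G e τ →
                ¬ DeadCond G i j q e i → ¬ DeadCond G i j q e j →
                Aug G (η i j q e) (ajoin i j q τ)
    aug-joinI : ∀ {i j q e τ} → Aug G e τ →
                DeadCond G i j q e i → ¬ DeadCond G i j q e j →
                Aug G (η i j q e) (adead i (ajoin i j q τ))
    aug-joinJ : ∀ {i j q e τ} → Aug G e τ →
                ¬ DeadCond G i j q e i → DeadCond G i j q e j →
                Aug G (η i j q e) (adead j (ajoin i j q τ))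
    aug-joinIJ : ∀ {i j q e τ} → Aug G e τ →
                DeadCond G i j q e i → DeadCond G i j q e j →
                Aug G (η i j q e) (adead i (adead j (ajoin i j q τ)))
    aug-joinJI : ∀ {i j q e τ} → Aug G e τ →
                DeadCond G i j q e i → DeadCond G i j q e j →
                Aug G (η i j q e) (adead j (adead i (ajoin i j q τ)))

  data Node : ATree n k → Set where
    here      : ∀ {τ} → Node τ
    inLeft    : ∀ {a b} → Node a → Node (aunion a b)
    inRight   : ∀ {a b} → Node b → Node (aunion a b)
    underRel  : ∀ {i j q a} → Node a → Node (arel i j q a)
    underJoin : ∀ {i j q a} → Node a → Node (ajoin i j q a)
    underDead : ∀ {ℓ a} → Node a → Node (adead ℓ a)

  subtreeAt : (τ : ATree n k) → Node τ → ATree n k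
  subtreeAt τ here = τ
  subtreeAt (aunion a b) (inLeft p) = subtreeAt a p
  subtreeAt (aunion a b) (inRight p) = subtreeAt b p
  subtreeAt (arel i j q a) (underRel p) = subtreeAt a p
  subtreeAt (ajoin i j q a) (underJoin p) = subtreeAt a p
  subtreeAt (adead ℓ a) (underDead p) = subtreeAt a p

  IsRoot : ∀ {τ} → Node τ → Set
  IsRoot here = ⊤
  IsRoot _ = ⊥

  ChildOfDead : ∀ {τ} → Node τ → Set
  ChildOfDead here = ⊥
  ChildOfDead (inLeft p) = ChildOfDead p
  ChildOfDead (inRight p) = ChildOfDead p
  ChildOfDead (underRel p) = ChildOfDead p
  ChildOfDead (underJoin p) = ChildOfDead p
  ChildOfDead (underDead p) = IsRoot p ⊎ ChildOfDead p

  Live : ATree n k → Fin k → Set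
  Live (aintro ℓ v) m = m ≡ ℓ
  Live (aunion a b) m = Live a m ⊎ Live b m
  Live (arel i j _ a) m = Live a m × m ≢ i
  Live (ajoin i j _ a) m = Live a m
  Live (adead ℓ a) m = Live a m × m ≢ ℓ

{-# OPTIONS --safe #-}

-- Along any clique-expression of G, the edges of G_t are edges of G, and vertices sharing a
-- label in G_t miss the same G-edges (later joins add them uniformly); hence deadness is
-- constant on label classes.  By induction on the augmented tree, a label is live iff its
-- class is undead: a leaf vertex is undead since G has no isolated vertex; relabelling i into
-- the nonempty class j merges two classes; and a join kills a whole class only for i or j,
-- which is exactly when the dead node removing that label is inserted.  At the child of such a
-- dead node the class is already dead but the label not yet removed, so only one direction holds.
module Submission where

open import Defs
open import Data.Nat using (ℕ; _≤_; s≤s)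
open import Data.Fin using (Fin; _≟_; punchIn) renaming (zero to fzero)
open import Data.Fin.Properties using (punchInᵢ≢i)
open import Data.Product using (∃; _×_; _,_; proj₁; proj₂)
open import Data.Sum using (inj₁; inj₂)
open import Data.Empty using (⊥; ⊥-elim)
open import Function using (_∘_)
open import Relation.Nullary using (¬_; yes; no)
open import Relation.Binary.PropositionalEquality using (_≡_; _≢_; refl; ≢-sym; subst; cong; cong₂)
open import Relation.Binary.Construct.Closure.ReflexiveTransitive using (Star; ε; _◅_)

connected⇒neighbour : ∀ {n} (G : Graph n) → 2 ≤ n → Connected G → ∀ v → ∃ (E G v)
connected⇒neighbour G (s≤s (s≤s _)) conn v =
  first-step (punchInᵢ≢i v fzero) (conn v (punchIn v fzero))
  where
  first-step : ∀ {u} → u ≢ v → Star (E G) v u → ∃ (E G v)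
  first-step u≢v ε = ⊥-elim (u≢v refl)
  first-step _ (g ◅ _) = _ , g

module _ {n k : ℕ} where

  lab-unique : ∀ (e : Expr n k) {a m m′} → DisjointUnions e → Lab e a m → Lab e a m′ → m ≡ m′
  lab-unique (intro ℓ v) _ (_ , refl) (_ , refl) = refl
  lab-unique (e₁ ⊕ e₂) (d₁ , _ , _) (inj₁ x) (inj₁ y) = lab-unique e₁ d₁ x y
  lab-unique (e₁ ⊕ e₂) (_ , _ , dj) (inj₁ x) (inj₂ y) = ⊥-elim (dj _ (_ , x) (_ , y))
  lab-unique (e₁ ⊕ e₂) (_ , _ , dj) (inj₂ x) (inj₁ y) = ⊥-elim (dj _ (_ , y) (_ , x))
  lab-unique (e₁ ⊕ e₂) (_ , d₂ , _) (inj₂ x) (inj₂ y) = lab-unique e₂ d₂ x y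
  lab-unique (ρ i j q e) d (inj₁ (x , _)) (inj₁ (y , _)) = lab-unique e d x y
  lab-unique (ρ i j q e) d (inj₁ (x , m≢i)) (inj₂ (y , _)) = ⊥-elim (m≢i (lab-unique e d x y))
  lab-unique (ρ i j q e) d (inj₂ (x , _)) (inj₁ (y , m′≢i)) = ⊥-elim (m′≢i (lab-unique e d y x))
  lab-unique (ρ i j q e) d (inj₂ (_ , refl)) (inj₂ (_ , refl)) = refl
  lab-unique (η i j q e) d x y = lab-unique e d x y

  ρ-sameLabel : ∀ {i j} (q : i ≢ j) (e : Expr n k) {a b m} → Lab e a m → Lab e b m →
                ∃ λ m′ → Lab (ρ i j q e) a m′ × Lab (ρ i j q e) b m′
  ρ-sameLabel {i} {j} q e {m = m} la lb with m ≟ i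
  ... | yes refl = j , inj₂ (la , refl) , inj₂ (lb , refl)
  ... | no m≢i = m , inj₁ (la , m≢i) , inj₁ (lb , m≢i)

  edge⇒inV : ∀ (e : Expr n k) {a b} → Edge e a b → InV e a
  edge⇒inV (e₁ ⊕ e₂) (inj₁ x) = let (m , l) = edge⇒inV e₁ x in m , inj₁ l
  edge⇒inV (e₁ ⊕ e₂) (inj₂ x) = let (m , l) = edge⇒inV e₂ x in m , inj₂ l
  edge⇒inV (ρ i j q e) x =
    let (m , l) = edge⇒inV e x
        (m′ , l′ , _) = ρ-sameLabel q e l l
    in m′ , l′
  edge⇒inV (η i j q e) (inj₁ x) = edge⇒inV e x
  edge⇒inV (η i j q e) (inj₂ (inj₁ (l , _))) = i , l
  edge⇒inV (η i j q e) (inj₂ (inj₂ (l , _))) = j , l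

  edge-sym : ∀ (e : Expr n k) {a b} → Edge e a b → Edge e b a
  edge-sym (e₁ ⊕ e₂) (inj₁ x) = inj₁ (edge-sym e₁ x)
  edge-sym (e₁ ⊕ e₂) (inj₂ x) = inj₂ (edge-sym e₂ x)
  edge-sym (ρ i j q e) x = edge-sym e x
  edge-sym (η i j q e) (inj₁ x) = inj₁ (edge-sym e x)
  edge-sym (η i j q e) (inj₂ (inj₁ (la , lb))) = inj₂ (inj₂ (lb , la))
  edge-sym (η i j q e) (inj₂ (inj₂ (la , lb))) = inj₂ (inj₁ (lb , la))

  record Summand (e′ e : Expr n k) : Set where
    field
      lab   : ∀ {a m} → Lab e′ a m → Lab e a m
      edge  : ∀ {a b} → Edge e′ a b → Edge e a b
      edge⁻ : ∀ {a b} → InV e′ a → Edge e a b → Edge e′ a b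

  summandˡ : ∀ (e₁ e₂ : Expr n k) → DisjointUnions (e₁ ⊕ e₂) → Summand e₁ (e₁ ⊕ e₂)
  summandˡ e₁ e₂ (_ , _ , dj) = record { lab = inj₁ ; edge = inj₁ ; edge⁻ = edge⁻ }
    where
    edge⁻ : ∀ {a b} → InV e₁ a → Edge (e₁ ⊕ e₂) a b → Edge e₁ a b
    edge⁻ _ (inj₁ x) = x
    edge⁻ a∈e₁ (inj₂ x) = ⊥-elim (dj _ a∈e₁ (edge⇒inV e₂ x))

  summandʳ : ∀ (e₁ e₂ : Expr n k) → DisjointUnions (e₁ ⊕ e₂) → Summand e₂ (e₁ ⊕ e₂)
  summandʳ e₁ e₂ (_ , _ , dj) = record { lab = inj₂ ; edge = inj₂ ; edge⁻ = edge⁻ }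
    where
    edge⁻ : ∀ {a b} → InV e₂ a → Edge (e₁ ⊕ e₂) a b → Edge e₂ a b
    edge⁻ a∈e₂ (inj₁ x) = ⊥-elim (dj _ (edge⇒inV e₁ x) a∈e₂)
    edge⁻ _ (inj₂ x) = x

  erase-aug : ∀ {G : Graph n} {e : Expr n k} {τ} → Aug G e τ → erase τ ≡ e
  erase-aug aug-intro = refl
  erase-aug (aug-union a₁ a₂) = cong₂ _⊕_ (erase-aug a₁) (erase-aug a₂)
  erase-aug (aug-rel {i} {j} {q} a) = cong (ρ i j q) (erase-aug a)
  erase-aug (aug-join0 {i} {j} {q} a _ _) = cong (η i j q) (erase-aug a)
  erase-aug (aug-joinI {i} {j} {q} a _ _) = cong (η i j q) (erase-aug a)
  erase-aug (aug-joinJ {i} {j} {q} a _ _) = cong (η i j q) (erase-aug a)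
  erase-aug (aug-joinIJ {i} {j} {q} a _ _) = cong (η i j q) (erase-aug a)
  erase-aug (aug-joinJI {i} {j} {q} a _ _) = cong (η i j q) (erase-aug a)

module _ {n k : ℕ} (G : Graph n) where

  Settled : Expr n k → Fin n → Fin n → Set
  Settled e v x = E G v x → Edge e v x

  Sound : Expr n k → Set
  Sound e = ∀ {a b} → Edge e a b → E G a b

  -- The G-edges still missing from G_e are all added by later joins, which treat a
  -- label class uniformly; so for μ and all its subexpressions, Sound and Homogeneous hold.
  Homogeneous : Expr n k → Set
  Homogeneous e = ∀ {c v w x} → Lab e v c → Lab e w c → Settled e v x → Settled e w x

  Invariant : Expr n k → Set
  Invariant e = Sound e × Homogeneous e

  exprOf⇒invariant : ∀ (μ : Expr n k) → IsExprOf G μ → Invariant μ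
  exprOf⇒invariant μ (_ , _ , ed) = proj₁ (ed _ _) , λ _ _ _ → proj₂ (ed _ _)

  invariant-summand : ∀ {e′ e : Expr n k} → Summand e′ e → Invariant e → Invariant e′
  invariant-summand s (sound , h) =
    sound ∘ edge , λ lv lw sv → edge⁻ (_ , lw) ∘ h (lab lv) (lab lw) (edge ∘ sv)
    where open Summand s

  invariant-ρ : ∀ {i j} (q : i ≢ j) (e : Expr n k) → Invariant (ρ i j q e) → Invariant e
  invariant-ρ q e (sound , h) = sound , λ lv lw →
    let (_ , lv′ , lw′) = ρ-sameLabel q e lv lw in h lv′ lw′

  invariant-η : ∀ {i j} (q : i ≢ j) (e : Expr n k) → DisjointUnions e →
                (∀ u v → Lab e u i → Lab e v j → ¬ Edge e u v) →
                Invariant (η i j q e) → Invariant e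
  invariant-η {i} {j} q e d irr (sound , h) = sound ∘ inj₁ , homogeneous
    where
    -- A join edge wx would make vx a join edge too, hence a G-edge (soundness), hence an
    -- edge of G_e by sv, contradicting irredundancy.
    homogeneous : Homogeneous e
    homogeneous {v = v} {w} {x} lv lw sv g with h lv lw (inj₁ ∘ sv) g
    ... | inj₁ wx = wx
    ... | inj₂ (inj₁ (wi , xj)) =
      let vi = subst (Lab e v) (lab-unique e d lw wi) lv
      in ⊥-elim (irr v x vi xj (sv (sound (inj₂ (inj₁ (vi , xj))))))
    ... | inj₂ (inj₂ (wj , xi)) =
      let vj = subst (Lab e v) (lab-unique e d lw wj) lv
      in ⊥-elim (irr x v xi vj (edge-sym e (sv (sound (inj₂ (inj₂ (vj , xi)))))))

  dead-homogeneous : ∀ (e : Expr n k) {c v w} → Homogeneous e →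
                     Lab e v c → Lab e w c → Dead G e v → Dead G e w
  dead-homogeneous e h lv lw (_ , dv) = (_ , lw) , λ x → h lv lw (dv x)

  dead-summand : ∀ {e′ e : Expr n k} {v} → Summand e′ e → Dead G e′ v → Dead G e v
  dead-summand s ((_ , l) , dv) = (_ , lab l) , λ x → edge ∘ dv x
    where open Summand s

  dead-summand⁻ : ∀ {e′ e : Expr n k} {v} → Summand e′ e → InV e′ v → Dead G e v → Dead G e′ v
  dead-summand⁻ s v∈e′ (_ , dv) = v∈e′ , λ x → edge⁻ v∈e′ ∘ dv x
    where open Summand s

  dead-η : ∀ {i j} (q : i ≢ j) (e : Expr n k) {v} → Dead G e v → Dead G (η i j q e) v
  dead-η q e (v∈e , dv) = v∈e , λ x → inj₁ ∘ dv x

  dead-η⁻ : ∀ {i j} (q : i ≢ j) (e : Expr n k) {u m} → DisjointUnions e → Lab e u m → m ≢ i → m ≢ j →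
            Dead G (η i j q e) u → Dead G e u
  dead-η⁻ q e {u} d lu m≢i m≢j (_ , du) = (_ , lu) , settled
    where
    settled : ∀ x → Settled e u x
    settled x g with du x g
    ... | inj₁ ux = ux
    ... | inj₂ (inj₁ (ui , _)) = ⊥-elim (m≢i (lab-unique e d lu ui))
    ... | inj₂ (inj₂ (uj , _)) = ⊥-elim (m≢j (lab-unique e d lu uj))

  newlyDead⇒deadCond : ∀ {i j} (q : i ≢ j) (e : Expr n k) {u m} →
                       Homogeneous e → Homogeneous (η i j q e) →
                       Lab e u m → ¬ Dead G e u → Dead G (η i j q e) u → DeadCond G i j q e m
  newlyDead⇒deadCond {i} {j} q e h hη lu nd du v lv =
    dead-homogeneous (η i j q e) hη lu lv du , nd ∘ dead-homogeneous e h lv lu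

  record UndeadIsLive (e : Expr n k) (s : ATree n k) : Set where
    constructor undeadIsLive
    field undead⇒live : ∀ {m v} → Lab e v m → ¬ Dead G e v → Live s m

  record LiveHasUndead (e : Expr n k) (s : ATree n k) : Set where
    constructor liveHasUndead
    field live⇒undead : ∀ {m} → Live s m → ∃ λ u → Lab e u m × ¬ Dead G e u

  open UndeadIsLive public
  open LiveHasUndead public

  LiveIsUndead : Expr n k → ATree n k → Set
  LiveIsUndead e s = ∀ {m v} → Live s m → Lab e v m → ¬ Dead G e v

  liveHasUndead⇒liveIsUndead : ∀ {e : Expr n k} {s} → Homogeneous e →
                               LiveHasUndead e s → LiveIsUndead e s
  liveHasUndead⇒liveIsUndead {e} h H L lv dv =
    let (u , lu , nd) = live⇒undead H L in nd (dead-homogeneous e h lv lu dv)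

  undeadIsLive-intro : ∀ {ℓ v} → UndeadIsLive (intro ℓ v) (aintro ℓ v)
  undeadIsLive-intro = undeadIsLive λ (_ , m≡ℓ) _ → m≡ℓ

  liveHasUndead-intro : (∀ v → ∃ (E G v)) → ∀ {ℓ v} → LiveHasUndead (intro ℓ v) (aintro ℓ v)
  liveHasUndead-intro nbr {v = v} = liveHasUndead λ m≡ℓ →
    v , (refl , m≡ℓ) , λ (_ , dv) → let (x , g) = nbr v in dv x g

  undeadIsLive-⊕ : ∀ {e₁ e₂ : Expr n k} {s₁ s₂} → DisjointUnions (e₁ ⊕ e₂) →
                   UndeadIsLive e₁ s₁ → UndeadIsLive e₂ s₂ → UndeadIsLive (e₁ ⊕ e₂) (aunion s₁ s₂)
  undeadIsLive-⊕ {e₁} {e₂} d U₁ U₂ = undeadIsLive λ where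
    (inj₁ l) nd → inj₁ (undead⇒live U₁ l (nd ∘ dead-summand (summandˡ e₁ e₂ d)))
    (inj₂ l) nd → inj₂ (undead⇒live U₂ l (nd ∘ dead-summand (summandʳ e₁ e₂ d)))

  liveHasUndead-⊕ : ∀ {e₁ e₂ : Expr n k} {s₁ s₂} → DisjointUnions (e₁ ⊕ e₂) →
                    LiveHasUndead e₁ s₁ → LiveHasUndead e₂ s₂ → LiveHasUndead (e₁ ⊕ e₂) (aunion s₁ s₂)
  liveHasUndead-⊕ {e₁} {e₂} d H₁ H₂ = liveHasUndead λ where
    (inj₁ L) → let (u , l , nd) = live⇒undead H₁ L
               in u , inj₁ l , nd ∘ dead-summand⁻ (summandˡ e₁ e₂ d) (_ , l)
    (inj₂ L) → let (u , l , nd) = live⇒undead H₂ L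
               in u , inj₂ l , nd ∘ dead-summand⁻ (summandʳ e₁ e₂ d) (_ , l)

  -- The old j-vertices exist by niceness and share their class with the relabelled
  -- i-vertices, so they are undead whenever one of those is.
  undeadIsLive-ρ : ∀ {i j} {q : i ≢ j} {e : Expr n k} {s} → Homogeneous (ρ i j q e) →
                   NonEmptyLabel e j → UndeadIsLive e s → UndeadIsLive (ρ i j q e) (arel i j q s)
  undeadIsLive-ρ {i} {j} {q} {e} h (u , lu) U = undeadIsLive λ where
    (inj₁ (l , m≢i)) nd → undead⇒live U l (λ (_ , dv) → nd ((_ , inj₁ (l , m≢i)) , dv)) , m≢i
    (inj₂ (li , refl)) nd →
      let lu′ = inj₁ (lu , ≢-sym q)
          undead-u : ¬ Dead G e u
          undead-u (_ , du) = nd (dead-homogeneous (ρ i j q e) h lu′ (inj₂ (li , refl)) ((_ , lu′) , du))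
      in undead⇒live U lu undead-u , ≢-sym q

  liveHasUndead-ρ : ∀ {i j} {q : i ≢ j} {e : Expr n k} {s} →
                    LiveHasUndead e s → LiveHasUndead (ρ i j q e) (arel i j q s)
  liveHasUndead-ρ H = liveHasUndead λ (L , m≢i) →
    let (u , l , nd) = live⇒undead H L in u , inj₁ (l , m≢i) , λ (_ , du) → nd ((_ , l) , du)

  undeadIsLive-η : ∀ {i j} {q : i ≢ j} {e : Expr n k} {s} →
                   UndeadIsLive e s → UndeadIsLive (η i j q e) (ajoin i j q s)
  undeadIsLive-η {q = q} {e} U = undeadIsLive λ l nd → undead⇒live U l (nd ∘ dead-η q e)

  undeadIsLive-dead : ∀ {i j} {q : i ≢ j} {e : Expr n k} {s ℓ} → DeadCond G i j q e ℓ →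
                      UndeadIsLive (η i j q e) s → UndeadIsLive (η i j q e) (adead ℓ s)
  undeadIsLive-dead dc U = undeadIsLive λ l nd → undead⇒live U l nd , λ { refl → nd (proj₁ (dc _ l)) }

  -- σ is the topmost of the join node and the dead nodes inserted above it; the last
  -- hypothesis holds because dead_i (dead_j) is inserted exactly when this join kills label i (j).
  liveHasUndead-η : ∀ {i j} (q : i ≢ j) (e : Expr n k) {s σ} → DisjointUnions e →
                    Homogeneous e → Homogeneous (η i j q e) → LiveHasUndead e s →
                    (∀ {m} → Live σ m → Live s m × (DeadCond G i j q e m → m ≢ i × m ≢ j)) →
                    LiveHasUndead (η i j q e) σ
  liveHasUndead-η q e d h hη H below = liveHasUndead λ L →
    let (L′ , not-joined) = below L
        (u , l , nd) = live⇒undead H L′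
    in u , l , λ du →
      let (m≢i , m≢j) = not-joined (newlyDead⇒deadCond q e h hη l nd du)
      in nd (dead-η⁻ q e d l m≢i m≢j du)

  LiveLabelsAt : ATree n k → Set → Set
  LiveLabelsAt s childOfDead = UndeadIsLive (erase s) s × (¬ childOfDead → LiveIsUndead (erase s) s)

  liveLabelsAt-root : ∀ {e : Expr n k} {τ} → erase τ ≡ e → Homogeneous e →
                      UndeadIsLive e τ × LiveHasUndead e τ → LiveLabelsAt τ ⊥
  liveLabelsAt-root refl h (U , H) = U , λ _ → liveHasUndead⇒liveIsUndead h H

  liveLabelsAt-childOfDead : ∀ {e : Expr n k} {s C} → erase s ≡ e →
                             UndeadIsLive e s → C → LiveLabelsAt s C
  liveLabelsAt-childOfDead refl U c = U , λ ¬c → ⊥-elim (¬c c)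

  liveLabelsAt-mono : ∀ {s C C′} → (C → C′) → LiveLabelsAt s C → LiveLabelsAt s C′
  liveLabelsAt-mono f (U , I) = U , λ ¬c′ → I (¬c′ ∘ f)

  module _ (nbr : ∀ v → ∃ (E G v)) where

    liveLabels-aug : ∀ {e : Expr n k} {τ} → Aug G e τ →
                     DisjointUnions e → Nice e → Invariant e → UndeadIsLive e τ × LiveHasUndead e τ

    liveLabels-aug-below : ∀ {i j} (q : i ≢ j) (e : Expr n k) {τ} → Aug G e τ →
                         DisjointUnions e → Nice (η i j q e) → Invariant (η i j q e) →
                         Homogeneous e × UndeadIsLive e τ × LiveHasUndead e τ
    liveLabels-aug-below q e a d (ni , irr , _) inv =
      let inv′ = invariant-η q e d irr inv in proj₂ inv′ , liveLabels-aug a d ni inv′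

    liveLabels-aug aug-intro _ _ _ = undeadIsLive-intro , liveHasUndead-intro nbr
    liveLabels-aug (aug-union {e₁} {e₂} a₁ a₂) d@(d₁ , d₂ , _) (n₁ , n₂) inv =
      let (U₁ , H₁) = liveLabels-aug a₁ d₁ n₁ (invariant-summand (summandˡ e₁ e₂ d) inv)
          (U₂ , H₂) = liveLabels-aug a₂ d₂ n₂ (invariant-summand (summandʳ e₁ e₂ d) inv)
      in undeadIsLive-⊕ d U₁ U₂ , liveHasUndead-⊕ d H₁ H₂
    liveLabels-aug (aug-rel {q = q} {e} a) d (ni , _ , j-nonempty) inv =
      let (U , H) = liveLabels-aug a d ni (invariant-ρ q e inv)
      in undeadIsLive-ρ (proj₂ inv) j-nonempty U , liveHasUndead-ρ H
    liveLabels-aug (aug-join0 {q = q} {e} a ni nj) d nc inv =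
      let (h , U , H) = liveLabels-aug-below q e a d nc inv
      in undeadIsLive-η U ,
         liveHasUndead-η q e d h (proj₂ inv) H
           (λ L → L , λ dc → (λ { refl → ni dc }) , (λ { refl → nj dc }))
    liveLabels-aug (aug-joinI {q = q} {e} a di nj) d nc inv =
      let (h , U , H) = liveLabels-aug-below q e a d nc inv
      in undeadIsLive-dead di (undeadIsLive-η U) ,
         liveHasUndead-η q e d h (proj₂ inv) H
           (λ (L , m≢i) → L , λ dc → m≢i , (λ { refl → nj dc }))
    liveLabels-aug (aug-joinJ {q = q} {e} a ni dj) d nc inv =
      let (h , U , H) = liveLabels-aug-below q e a d nc inv
      in undeadIsLive-dead dj (undeadIsLive-η U) ,
         liveHasUndead-η q e d h (proj₂ inv) H
           (λ (L , m≢j) → L , λ dc → (λ { refl → ni dc }) , m≢j)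
    liveLabels-aug (aug-joinIJ {q = q} {e} a di dj) d nc inv =
      let (h , U , H) = liveLabels-aug-below q e a d nc inv
      in undeadIsLive-dead di (undeadIsLive-dead dj (undeadIsLive-η U)) ,
         liveHasUndead-η q e d h (proj₂ inv) H (λ ((L , m≢j) , m≢i) → L , λ _ → m≢i , m≢j)
    liveLabels-aug (aug-joinJI {q = q} {e} a di dj) d nc inv =
      let (h , U , H) = liveLabels-aug-below q e a d nc inv
      in undeadIsLive-dead dj (undeadIsLive-dead di (undeadIsLive-η U)) ,
         liveHasUndead-η q e d h (proj₂ inv) H (λ ((L , m≢i) , m≢j) → L , λ _ → m≢i , m≢j)

    undeadIsLive-ajoin : ∀ {i j} (q : i ≢ j) (e : Expr n k) {τ} → Aug G e τ →
                         DisjointUnions e → Nice (η i j q e) → Invariant (η i j q e) →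
                         UndeadIsLive (η i j q e) (ajoin i j q τ)
    undeadIsLive-ajoin q e a d nc inv = undeadIsLive-η (proj₁ (proj₂ (liveLabels-aug-below q e a d nc inv)))

    liveLabels-node : ∀ {e : Expr n k} {τ} → Aug G e τ →
                      DisjointUnions e → Nice e → Invariant e →
                      (t : Node τ) → LiveLabelsAt (subtreeAt τ t) (ChildOfDead t)

    liveLabels-node-below : ∀ {i j} (q : i ≢ j) (e : Expr n k) {τ} → Aug G e τ →
                            DisjointUnions e → Nice (η i j q e) → Invariant (η i j q e) →
                            (t : Node τ) → LiveLabelsAt (subtreeAt τ t) (ChildOfDead t)
    liveLabels-node-below q e a d (ni , irr , _) inv = liveLabels-node a d ni (invariant-η q e d irr inv)

    liveLabels-node a d ni inv here = liveLabelsAt-root (erase-aug a) (proj₂ inv) (liveLabels-aug a d ni inv)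
    liveLabels-node (aug-union {e₁} {e₂} a₁ a₂) d@(d₁ , _ , _) (n₁ , _) inv (inLeft t) =
      liveLabels-node a₁ d₁ n₁ (invariant-summand (summandˡ e₁ e₂ d) inv) t
    liveLabels-node (aug-union {e₁} {e₂} a₁ a₂) d@(_ , d₂ , _) (_ , n₂) inv (inRight t) =
      liveLabels-node a₂ d₂ n₂ (invariant-summand (summandʳ e₁ e₂ d) inv) t
    liveLabels-node (aug-rel {q = q} {e} a) d (ni , _) inv (underRel t) =
      liveLabels-node a d ni (invariant-ρ q e inv) t
    liveLabels-node (aug-join0 {q = q} {e} a _ _) d nc inv (underJoin t) =
      liveLabels-node-below q e a d nc inv t
    liveLabels-node (aug-joinI {q = q} {e} a _ _) d nc inv (underDead here) =
      liveLabelsAt-childOfDead (cong (η _ _ q) (erase-aug a)) (undeadIsLive-ajoin q e a d nc inv) (inj₁ _)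
    liveLabels-node (aug-joinI {q = q} {e} a _ _) d nc inv (underDead (underJoin t)) =
      liveLabelsAt-mono inj₂ (liveLabels-node-below q e a d nc inv t)
    liveLabels-node (aug-joinJ {q = q} {e} a _ _) d nc inv (underDead here) =
      liveLabelsAt-childOfDead (cong (η _ _ q) (erase-aug a)) (undeadIsLive-ajoin q e a d nc inv) (inj₁ _)
    liveLabels-node (aug-joinJ {q = q} {e} a _ _) d nc inv (underDead (underJoin t)) =
      liveLabelsAt-mono inj₂ (liveLabels-node-below q e a d nc inv t)
    liveLabels-node (aug-joinIJ {q = q} {e} a _ dj) d nc inv (underDead here) =
      liveLabelsAt-childOfDead (cong (η _ _ q) (erase-aug a))
        (undeadIsLive-dead dj (undeadIsLive-ajoin q e a d nc inv)) (inj₁ _)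
    liveLabels-node (aug-joinIJ {q = q} {e} a _ _) d nc inv (underDead (underDead here)) =
      liveLabelsAt-childOfDead (cong (η _ _ q) (erase-aug a)) (undeadIsLive-ajoin q e a d nc inv) (inj₂ (inj₁ _))
    liveLabels-node (aug-joinIJ {q = q} {e} a _ _) d nc inv (underDead (underDead (underJoin t))) =
      liveLabelsAt-mono (inj₂ ∘ inj₂) (liveLabels-node-below q e a d nc inv t)
    liveLabels-node (aug-joinJI {q = q} {e} a di _) d nc inv (underDead here) =
      liveLabelsAt-childOfDead (cong (η _ _ q) (erase-aug a))
        (undeadIsLive-dead di (undeadIsLive-ajoin q e a d nc inv)) (inj₁ _)
    liveLabels-node (aug-joinJI {q = q} {e} a _ _) d nc inv (underDead (underDead here)) =
      liveLabelsAt-childOfDead (cong (η _ _ q) (erase-aug a)) (undeadIsLive-ajoin q e a d nc inv) (inj₂ (inj₁ _))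
    liveLabels-node (aug-joinJI {q = q} {e} a _ _) d nc inv (underDead (underDead (underJoin t))) =
      liveLabelsAt-mono (inj₂ ∘ inj₂) (liveLabels-node-below q e a d nc inv t)

lemma16 : ∀ {n k : ℕ} (G : Graph n) → 2 ≤ n → Connected G →
          (μ : Expr n k) → IsExprOf G μ → Nice μ →
          (τ : ATree n k) → Aug G μ τ →
          (t : Node τ) (ℓ : Fin k) →
          (∃ λ v → Lab (erase (subtreeAt τ t)) v ℓ) →
          ((∀ v → Lab (erase (subtreeAt τ t)) v ℓ → ¬ Dead G (erase (subtreeAt τ t)) v) →
             Live (subtreeAt τ t) ℓ)
          × (¬ ChildOfDead t →
             Live (subtreeAt τ t) ℓ →
             ∀ v → Lab (erase (subtreeAt τ t)) v ℓ → ¬ Dead G (erase (subtreeAt τ t)) v)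
lemma16 G two conn μ exprOf nice τ a t ℓ (v , lv) =
  let (U , I) = liveLabels-node G (connected⇒neighbour G two conn) a (proj₁ exprOf) nice
                  (exprOf⇒invariant G μ exprOf) t
  in (λ undead → undead⇒live U lv (undead v lv)) , λ ¬c L _ lw → I ¬c L lw
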